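{- Let $M,N\in\Lambda^{001}_\infty$. If $M\to_\beta^\infty N$, then there exist terms $M_0,M_1,M_2,\dots\in\Lambda^{001}_\infty$ with $M_0=M$ such that, for every $d\in\mathbf N$, $M_d\to_{\beta\ge d}^*M_{d+1}$ and $M_d\to_{\beta\ge d}^{\infty}N$; that is, for all $d$: $M=M_0\to_{\beta\ge0}^*M_1\to_{\beta\ge1}^*M_2\to_{\beta\ge 2}^*\cdots\to_{\beta\ge d-1}^*M_d\to_{\beta\ge d}^\infty N$.
   Context: Fix an infinite set $\mathcal V$ of variables. $\Lambda^{001}_\infty=\nu Y.\mu X.(\mathcal V+\lambda\mathcal V.X+(X)Y)$ is the set of possibly infinite syntax trees built from variables, abstractions $\lambda x.M$ and applications $(M)N$, in which every infinite branch passes infinitely often through the argument (right) subterm of an application; terms are up to α-equivalence. $\to_\beta$ is one-step β-reduction (contextual closure of $(\lambda x.M)N\mapsto M[N/x]$), $\to_\beta^*$ its reflexive–transitive closure, and $\to_\beta^\infty$ the 001-strongly convergent closure: $M\to_\beta^\infty x$ if $M\to_\beta^*x$; $M\to_\beta^\infty\lambda x.P'$ if $M\to_\beta^*\lambda x.P$, $P\to_\beta^\infty P'$; $M\to_\beta^\infty(P')Q'$ if $M\to_\beta^*(P)Q$, $P\to_\beta^\infty P'$, $Q\to_\beta^\infty Q'$, with possibly infinite derivations in which every infinite branch passes infinitely often through the premise $Q\to_\beta^\infty Q'$. Min-depth finitary reduction $\to_{\beta\ge d}$ ($d\in\mathbf N$) is defined inductively: $M\to_{\beta\ge0}N$ iff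 $M\to_\beta N$; and for $d\ge0$, if $M\to_{\beta\ge d+1}N$ then $\lambda x.M\to_{\beta\ge d+1}\lambda x.N$ and $(M)P\to_{\beta\ge d+1}(N)P$; if $M\to_{\beta\ge d}N$ then $(P)M\to_{\beta\ge d+1}(P)N$. $\to_{\beta\ge d}^*$ is its reflexive–transitive closure. Min-depth infinitary reduction $\to_{\beta\ge d}^\infty$ is defined inductively: $M\to_{\beta\ge0}^\infty M'$ iff $M\to_\beta^\infty M'$; and for $d\ge0$: $x\to_{\beta\ge d+1}^\infty x$; if $M\to_{\beta\ge d+1}^\infty M'$ then $\lambda x.M\to_{\beta\ge d+1}^\infty\lambda x.M'$; if $M\to_{\beta\ge d+1}^\infty M'$ and $N\to_{\beta\ge d}^\infty N'$ then $(M)N\to_{\beta\ge d+1}^\infty(M')N'$. -}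

module Defs where

open import Data.Nat using (ℕ; zero; suc; _+_; _∸_; _<ᵇ_)
open import Data.Bool using (if_then_else_)
open import Data.Product using (Σ; _×_)
open import Relation.Binary.PropositionalEquality using (_≡_; refl; cong; cong₂)

-- Λ^{001}_∞ = νY.μX.(V + λV.X + (X)Y)
--
-- A d is the inductive (μX) type of terms in which every
-- subterm lying below more than d argument (right) edges of applications
-- has been cut off: A 0 cuts every argument (app⊥), and the argument of an
-- application in A (suc d) lives in A d.  De Bruijn indices are used for
-- variables, so terms are automatically up to α-equivalence.

data A : ℕ → Set where
  var  : ∀ {d} → ℕ → A d
  lam  : ∀ {d} → A d → A d
  app⊥ : A zero → A zero
  app  : ∀ {d} → A (suc d) → A d → A (suc d)

trunc : ∀ {d} → A (suc d) → A d
trunc (var n) = var n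
trunc (lam M) = lam (trunc M)
trunc {zero}  (app M N) = app⊥ (trunc M)
trunc {suc d} (app M N) = app (trunc M) (trunc N)

-- A (possibly infinite) 001-term: a coherent sequence of approximations.
record Term : Set where
  field
    appr : (d : ℕ) → A d
    coh  : (d : ℕ) → trunc (appr (suc d)) ≡ appr d
open Term public

infix 4 _≈_
_≈_ : Term → Term → Set
M ≈ N = (d : ℕ) → appr M d ≡ appr N d

varT : ℕ → Term
appr (varT n) d = var n
coh  (varT n) d = refl

lamT : Term → Term
appr (lamT M) d = lam (appr M d)
coh  (lamT M) d = cong lam (coh M d)

appT : Term → Term → Term
appr (appT M N) zero    = app⊥ (appr M zero)
appr (appT M N) (suc d) = app (appr M (suc d)) (appr N d)
coh  (appT M N) zero    = cong app⊥ (coh M zero)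
coh  (appT M N) (suc d) = cong₂ app (coh M (suc d)) (coh N d)

shiftA : ∀ {d} → ℕ → ℕ → A d → A d
shiftA k c (var n)   = if n <ᵇ c then var n else var (n + k)
shiftA k c (lam M)   = lam (shiftA k (suc c) M)
shiftA k c (app⊥ M)  = app⊥ (shiftA k c M)
shiftA k c (app M N) = app (shiftA k c M) (shiftA k c N)

substA : ∀ {d} → (ℕ → Term) → ℕ → A d → A d
substA {d} σ k (var n) =
  if n <ᵇ k then var n else shiftA k 0 (appr (σ (n ∸ k)) d)
substA σ k (lam M)   = lam (substA σ (suc k) M)
substA σ k (app⊥ M)  = app⊥ (substA σ k M)
substA σ k (app M N) = app (substA σ k M) (substA σ k N)

sub0 : Term → ℕ → Term
sub0 N zero    = N
sub0 N (suc n) = varT n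

IsSubst0 : Term → Term → Term → Set
IsSubst0 M N P = (d : ℕ) → appr P d ≡ substA (sub0 N) 0 (appr M d)

infix 4 _→β_
data _→β_ : Term → Term → Set where
  beta  : ∀ {X Y M N} → X ≈ appT (lamT M) N → IsSubst0 M N Y → X →β Y
  ξlam  : ∀ {X Y M M'} → X ≈ lamT M → Y ≈ lamT M' → M →β M' → X →β Y
  ξappL : ∀ {X Y M M' N} → X ≈ appT M N → Y ≈ appT M' N → M →β M' → X →β Y
  ξappR : ∀ {X Y M N N'} → X ≈ appT M N → Y ≈ appT M N' → N →β N' → X →β Y

data Star (R : Term → Term → Set) : Term → Term → Set where
  done : ∀ {M N} → M ≈ N → Star R M N
  step : ∀ {M N P} → R M N → Star R N P → Star R M P

infix 4 _→β*_
_→β*_ : Term → Term → Set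
_→β*_ = Star _→β_

-- 001-strongly convergent reduction  →β^∞  = νY.μX.(rules), where the
-- coinductive variable Y is used only in the argument premise Q →∞ Q'.
-- The μX layer is the inductive type Step∞ R (with the argument premise
-- given by R); the ν layer is the greatest fixed point, defined (Knaster–
-- Tarski) as the union of all post-fixed points R ⊆ Step∞ R.

data Step∞ (R : Term → Term → Set) : Term → Term → Set where
  var : ∀ {M Y x} → M →β* varT x → Y ≈ varT x → Step∞ R M Y
  lam : ∀ {M Y P P'} → M →β* lamT P → Step∞ R P P' → Y ≈ lamT P' →
        Step∞ R M Y
  app : ∀ {M Y P P' Q Q'} → M →β* appT P Q → Step∞ R P P' → R Q Q' →
        Y ≈ appT P' Q' → Step∞ R M Y

infix 4 _→β∞_
_→β∞_ : Term → Term → Set₁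
M →β∞ N = Σ (Term → Term → Set) λ R →
            R M N × (∀ {X Y} → R X Y → Step∞ R X Y)

data _→β≥[_]_ : Term → ℕ → Term → Set where
  base : ∀ {M N} → M →β N → M →β≥[ zero ] N
  lam  : ∀ {d X Y M N} → X ≈ lamT M → Y ≈ lamT N →
         M →β≥[ suc d ] N → X →β≥[ suc d ] Y
  appL : ∀ {d X Y M N P} → X ≈ appT M P → Y ≈ appT N P →
         M →β≥[ suc d ] N → X →β≥[ suc d ] Y
  appR : ∀ {d X Y M N P} → X ≈ appT P M → Y ≈ appT P N →
         M →β≥[ d ] N → X →β≥[ suc d ] Y

_→β≥[_]*_ : Term → ℕ → Term → Set
M →β≥[ d ]* N = Star (λ X Y → X →β≥[ d ] Y) M N

data _→β≥[_]∞_ : Term → ℕ → Term → Set₁ where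
  base : ∀ {M M'} → M →β∞ M' → M →β≥[ zero ]∞ M'
  var  : ∀ {d X Y x} → X ≈ varT x → Y ≈ varT x → X →β≥[ suc d ]∞ Y
  lam  : ∀ {d X Y M M'} → X ≈ lamT M → Y ≈ lamT M' →
         M →β≥[ suc d ]∞ M' → X →β≥[ suc d ]∞ Y
  app  : ∀ {d X Y M M' N N'} → X ≈ appT M N → Y ≈ appT M' N' →
         M →β≥[ suc d ]∞ M' → N →β≥[ d ]∞ N' → X →β≥[ suc d ]∞ Y

{-# OPTIONS --safe #-}
module Submission where

-- Every derivation of M →β≥[ d ]∞ N factors as M →β≥[ d ]* M' →β≥[ d + 1 ]∞ N.
-- For d = 0, unfold the inductive layer of M →β∞ N along the spine (λ-bodies
-- and application heads): this collects finitely many β-steps at depth ≥ 0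
-- and leaves the coinductive premises below one argument edge, i.e. a
-- derivation at depth ≥ 1.  For d + 1, factor the subderivations
-- componentwise, that of an application argument at depth d.  Iterating from M →β≥[ 0 ]∞ N, which is
-- M →β∞ N, gives the sequence M₀, M₁, ….

open import Defs
open import Data.Nat using (ℕ; zero; suc)
open import Data.Product using (Σ; _×_; _,_; proj₁; proj₂)
open import Relation.Binary.PropositionalEquality using (_≡_; refl; cong; cong₂; trans)

-- Since _≈_ unfolds to pointwise equality of approximations, its endpoints
-- cannot be inferred from a proof; hence terms are passed explicitly and
-- reflexivity and transitivity are written pointwise.
Congruent≈ : (Term → Term) → Set
Congruent≈ F = ∀ X Y → X ≈ Y → F X ≈ F Y

lamT-cong : Congruent≈ lamT
lamT-cong X Y e d = cong lam (e d)

appT-congˡ : ∀ {Q} → Congruent≈ (λ P → appT P Q)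
appT-congˡ X Y e zero    = cong app⊥ (e zero)
appT-congˡ X Y e (suc d) = cong₂ app (e (suc d)) refl

appT-congʳ : ∀ {P} → Congruent≈ (appT P)
appT-congʳ X Y e zero    = refl
appT-congʳ X Y e (suc d) = cong₂ app refl (e d)

LeftRespects≈ : (Term → Term → Set) → Set
LeftRespects≈ R = ∀ {X X' Y} → X ≈ X' → R X' Y → R X Y

→β-respˡ-≈ : LeftRespects≈ _→β_
→β-respˡ-≈ e (beta e' s)      = beta (λ d → trans (e d) (e' d)) s
→β-respˡ-≈ e (ξlam e' e'' r)  = ξlam (λ d → trans (e d) (e' d)) e'' r
→β-respˡ-≈ e (ξappL e' e'' r) = ξappL (λ d → trans (e d) (e' d)) e'' r
→β-respˡ-≈ e (ξappR e' e'' r) = ξappR (λ d → trans (e d) (e' d)) e'' r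

→β≥-respˡ-≈ : ∀ {d} → LeftRespects≈ (λ X Y → X →β≥[ d ] Y)
→β≥-respˡ-≈ e (base r)        = base (→β-respˡ-≈ e r)
→β≥-respˡ-≈ e (lam e' e'' r)  = lam (λ d → trans (e d) (e' d)) e'' r
→β≥-respˡ-≈ e (appL e' e'' r) = appL (λ d → trans (e d) (e' d)) e'' r
→β≥-respˡ-≈ e (appR e' e'' r) = appR (λ d → trans (e d) (e' d)) e'' r

module _ {R : Term → Term → Set} (resp : LeftRespects≈ R) where

  Star-respˡ-≈ : LeftRespects≈ (Star R)
  Star-respˡ-≈ e (done e')  = done (λ d → trans (e d) (e' d))
  Star-respˡ-≈ e (step r s) = step (resp e r) s

  Star-trans : ∀ {X Y Z} → Star R X Y → Star R Y Z → Star R X Z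
  Star-trans (done e)   t = Star-respˡ-≈ e t
  Star-trans (step r s) t = step r (Star-trans s t)

Star-map : ∀ {R R' : Term → Term → Set} → (∀ {X Y} → R X Y → R' X Y) →
           ∀ {M N} → Star R M N → Star R' M N
Star-map f (done e)   = done e
Star-map f (step r s) = step (f r) (Star-map f s)

Star-gmap : ∀ {R R' : Term → Term → Set} (F : Term → Term) →
            Congruent≈ F →
            (∀ {X Y} → R X Y → R' (F X) (F Y)) →
            ∀ {P Q} → Star R P Q → Star R' (F P) (F Q)
Star-gmap F F-cong f {P} {Q} (done e) = done (F-cong P Q e)
Star-gmap F F-cong f (step r s)       = step (f r) (Star-gmap F F-cong f s)

record Factorisation (d : ℕ) (M N : Term) : Set₁ where
  field
    middle : Term
    finite : M →β≥[ d ]* middle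
    rest   : middle →β≥[ suc d ]∞ N
open Factorisation

Step∞-factorisation : ∀ {R} → (∀ {X Y} → R X Y → Step∞ R X Y) →
                      ∀ {M N} → Step∞ R M N →
                      Σ Term (λ M' → (M →β* M') × (M' →β≥[ 1 ]∞ N))
Step∞-factorisation post (var s e) = _ , s , var (λ _ → refl) e
Step∞-factorisation post (lam s p e)
  with P' , s' , q ← Step∞-factorisation post p =
  lamT P' ,
  Star-trans →β-respˡ-≈ s
    (Star-gmap lamT lamT-cong (ξlam (λ _ → refl) (λ _ → refl)) s') ,
  lam (λ _ → refl) e q
Step∞-factorisation {R} post (app {Q = Q} s p r e)
  with P' , s' , q ← Step∞-factorisation post p =
  appT P' Q ,
  Star-trans →β-respˡ-≈ s
    (Star-gmap (λ X → appT X Q) appT-congˡ (ξappL (λ _ → refl) (λ _ → refl)) s') ,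
  app (λ _ → refl) e q (base (R , r , post))

→β≥∞-factorisation : ∀ {d M N} → M →β≥[ d ]∞ N → Factorisation d M N
→β≥∞-factorisation (base (R , r , post))
  with M' , s , q ← Step∞-factorisation post (post r) =
  record { middle = M' ; finite = Star-map base s ; rest = q }
→β≥∞-factorisation (var {X = X} e e') =
  record { middle = X ; finite = done (λ _ → refl) ; rest = var e e' }
→β≥∞-factorisation (lam e e' p) =
  record
    { middle = lamT (middle f)
    ; finite = Star-respˡ-≈ →β≥-respˡ-≈ e
                 (Star-gmap lamT lamT-cong (lam (λ _ → refl) (λ _ → refl)) (finite f))
    ; rest   = lam (λ _ → refl) e' (rest f)
    }
  where f = →β≥∞-factorisation p
→β≥∞-factorisation (app {N = Q} e e' p p') =
  record
    { middle = appT (middle f) (middle f')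
    ; finite = Star-respˡ-≈ →β≥-respˡ-≈ e (Star-trans →β≥-respˡ-≈
                 (Star-gmap (λ X → appT X Q) appT-congˡ
                   (appL (λ _ → refl) (λ _ → refl)) (finite f))
                 (Star-gmap (appT (middle f)) appT-congʳ
                   (appR (λ _ → refl) (λ _ → refl)) (finite f')))
    ; rest   = app (λ _ → refl) e' (rest f) (rest f')
    }
  where f  = →β≥∞-factorisation p
        f' = →β≥∞-factorisation p'

depth-reduct : ∀ {M N} → M →β∞ N → (d : ℕ) → Σ Term (λ X → X →β≥[ d ]∞ N)
depth-reduct {M} p zero    = M , base p
depth-reduct p     (suc d) = middle f , rest f
  where f = →β≥∞-factorisation (proj₂ (depth-reduct p d))

lemma4p11 : (M N : Term) → M →β∞ N →
    Σ (ℕ → Term) (λ Ms → (Ms zero ≡ M) ×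
      ((d : ℕ) → (Ms d →β≥[ d ]* Ms (suc d)) × (Ms d →β≥[ d ]∞ N)))
lemma4p11 M N p =
  (λ d → proj₁ (depth-reduct p d)) , refl ,
  λ d → finite (→β≥∞-factorisation (proj₂ (depth-reduct p d))) ,
        proj₂ (depth-reduct p d)
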